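{- Let $G$ be a graph, $R\subseteq V(G)$, $v_0\in V(G)$, and $P$ a shortest path from $v_0$ to $R$, with $x$ its unique vertex in $R$. Then for every milestone $v$ of $P$, every vertex $u$ in the neutral prefix of $v$ in $P$, and every $y\in R$, it holds that $\mathrm{dist}(u,y)=|P[u,v]|+\mathrm{dist}(v,y)$.
   Context: Graphs are unweighted and undirected; $|Q|$ is the number of edges of a path $Q$, $\mathrm{dist}(u,v)$ the minimum length of a $u$–$v$ path, $\mathrm{dist}(v,R)=\min_{y\in R}\mathrm{dist}(v,y)$, and $P[a,b]$ the subpath of $P$ between $a,b$. A shortest path from $v_0$ to $R$ is a path from $v_0$ to a vertex of $R$ of length $\mathrm{dist}(v_0,R)$; it contains exactly one vertex $x$ of $R$. Order $V(P)$ by $\le_P$: $v\le_P u$ iff $u\in V(P[v,x])$. For $v\in V(G)$ let $\mathrm{prof}(v)\colon R\to\mathbb{Z}$, $\mathrm{prof}(v)(s)=\mathrm{dist}(v,s)-\mathrm{dist}(v,x)$. A vertex $v\in V(P)$ is a milestone of $P$ if $v=x$ or $\mathrm{prof}(v)\neq\mathrm{prof}(u)$ where $u$ is the successor of $v$ in $\le_P$. For a milestone $v$, the neutral prefix of $v$ in $P$ is the vertex set of the maximal subpath $Q$ of $P[v_0,v]$ such that $v$ is the only milestone of $P$ belonging to $Q$. -}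

module Defs where

open import Data.Nat using (ℕ; zero; suc; _+_; _∸_; _≤_; _<_)
open import Data.Integer using (ℤ; _⊖_)
open import Data.Fin using (Fin)
open import Data.Maybe using (Maybe; just; nothing; map)
open import Data.Product using (Σ; _×_; _,_)
open import Data.Sum using (_⊎_)
open import Relation.Nullary using (¬_)
open import Relation.Binary.PropositionalEquality using (_≡_)

record Graph (n : ℕ) : Set₁ where
  field
    Adj     : Fin n → Fin n → Set
    Adj-sym : ∀ {u v} → Adj u v → Adj v u
    Adj-irr : ∀ {v} → ¬ Adj v v
open Graph public

-- A path with k edges given by its vertex sequence w 0, w 1, …, w k
-- (values of w beyond index k are irrelevant): consecutive vertices are
-- adjacent and all vertices are distinct.
record IsPath {n : ℕ} (G : Graph n) (w : ℕ → Fin n) (k : ℕ) (a b : Fin n) : Set where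
  field
    start : w 0 ≡ a
    end   : w k ≡ b
    step  : ∀ i → i < k → Adj G (w i) (w (suc i))
    inj   : ∀ i j → i ≤ k → j ≤ k → w i ≡ w j → i ≡ j

-- Distance as an element of ℕ ∪ {∞} (nothing = ∞, no path exists).
-- IsDist G u v d : d is the minimum number of edges of a u–v path.
IsDist : {n : ℕ} → Graph n → Fin n → Fin n → Maybe ℕ → Set
IsDist {n} G u v (just k) =
  Σ (ℕ → Fin n) (λ w → IsPath G w k u v)
  × (∀ (w : ℕ → Fin n) (l : ℕ) → IsPath G w l u v → k ≤ l)
IsDist {n} G u v nothing = ∀ (w : ℕ → Fin n) (l : ℕ) → ¬ IsPath G w l u v

IsDistFun : {n : ℕ} → Graph n → (Fin n → Fin n → Maybe ℕ) → Set
IsDistFun G dist = ∀ u v → IsDist G u v (dist u v)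

_-∞_ : Maybe ℕ → Maybe ℕ → Maybe ℤ
just a -∞ just b = just (a ⊖ b)
_      -∞ _      = nothing

_+∞_ : ℕ → Maybe ℕ → Maybe ℕ
k +∞ d = map (k +_) d

prof : {n : ℕ} → (Fin n → Fin n → Maybe ℕ) → Fin n → Fin n → Fin n → Maybe ℤ
prof dist x v s = dist v s -∞ dist v x

IsShortestPathToSet : {n : ℕ} → Graph n → (Fin n → Fin n → Maybe ℕ) →
  (R : Fin n → Set) → Fin n → (P : ℕ → Fin n) → ℕ → Fin n → Set
IsShortestPathToSet G dist R v₀ P m x =
  IsPath G P m v₀ x × R x
  × (∀ y → R y → ∀ k → dist v₀ y ≡ just k → m ≤ k)

-- The vertex P i (i ≤ m) is a milestone of P: it is x (= P m), or its profile
-- differs from that of its successor P (suc i) in ≤_P.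
Milestone : {n : ℕ} → (Fin n → Fin n → Maybe ℕ) → (R : Fin n → Set) →
  (P : ℕ → Fin n) → ℕ → ℕ → Set
Milestone dist R P m i =
  i ≡ m ⊎ (i < m × ¬ (∀ s → R s → prof dist (P m) (P i) s ≡ prof dist (P m) (P (suc i)) s))

-- The vertex P i is in the neutral prefix of the milestone P j: the neutral
-- prefix is the vertex set of the maximal subpath P[P i', P j] (i' ≤ j) of
-- P[v₀, P j] containing no milestone other than P j, i.e. none of
-- P i', …, P (j-1) is a milestone. Since P is injective, vertices of P are
-- identified with their indices.
InNeutralPrefix : {n : ℕ} → (Fin n → Fin n → Maybe ℕ) → (R : Fin n → Set) →
  (P : ℕ → Fin n) → ℕ → ℕ → ℕ → Set
InNeutralPrefix dist R P m j i =
  i ≤ j × (∀ k → i ≤ k → k < j → ¬ Milestone dist R P m k)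

{-# OPTIONS --safe #-}
-- Along a shortest path P from v₀ to R the distance to the end x drops by
-- exactly one per step: a shortcut from P k to x, appended to P[v₀, P k],
-- would give a walk, hence a path, from v₀ to x ∈ R shorter than P. If P k
-- is not a milestone, its profile equals that of P (k + 1), and since the
-- distances to x differ by one, so do the distances to every y ∈ R. Chaining
-- these unit steps over the milestone-free stretch P[u, v] gives the claim.
module Submission where

open import Defs
open import Data.Nat using (ℕ; zero; suc; _+_; _∸_; _≤_; _<_; z≤n; s≤s; anyUpTo?)
open import Data.Nat.Properties hiding (_≟_)
open import Data.Fin using (Fin; _≟_)
open import Data.Integer as ℤ using (_⊖_)
import Data.Integer.Properties as ℤ
open import Algebra.Properties.AbelianGroup ℤ.+-0-abelianGroup using (∙-cancelʳ)
open import Data.Maybe using (Maybe; just; nothing)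
open import Data.Maybe.Properties using (≡-dec; just-injective; map-id; map-∘; map-cong)
open import Data.Product using (∃; ∃₂; _×_; _,_; proj₁; proj₂)
open import Data.Sum using (inj₂)
open import Relation.Nullary using (¬_; yes; no; contradiction)
open import Relation.Nullary.Decidable using (decidable-stable)
open import Relation.Binary.PropositionalEquality
open ≡-Reasoning

open IsPath

data Walk {n : ℕ} (G : Graph n) : Fin n → Fin n → ℕ → Set where
  []  : ∀ {a} → Walk G a a 0
  _∷_ : ∀ {a b c l} → Adj G a b → Walk G b c l → Walk G a c (suc l)

infixr 5 _∷_ _++_

_++_ : ∀ {n} {G : Graph n} {a b c k l} → Walk G a b k → Walk G b c l → Walk G a c (k + l)
[]      ++ q = q
(e ∷ p) ++ q = e ∷ (p ++ q)

cons : ∀ {n} → Fin n → (ℕ → Fin n) → ℕ → Fin n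
cons a p zero    = a
cons a p (suc i) = p i

module _ {n : ℕ} {G : Graph n} where

  IsPath⇒Walk : ∀ {w k a b} → IsPath G w k a b → Walk G a b k
  IsPath⇒Walk {w} {k} path = subst₂ (λ a b → Walk G a b k) (start path) (end path)
    (steps⇒Walk w k (step path))
    where
    steps⇒Walk : ∀ w k → (∀ i → i < k → Adj G (w i) (w (suc i))) → Walk G (w 0) (w k) k
    steps⇒Walk w zero    _     = []
    steps⇒Walk w (suc k) steps =
      steps 0 (s≤s z≤n) ∷ steps⇒Walk (λ i → w (suc i)) k (λ i i<k → steps (suc i) (s≤s i<k))

  IsPath-trivial : ∀ a → IsPath G (λ _ → a) 0 a a
  IsPath-trivial a .start = refl
  IsPath-trivial a .end   = refl
  IsPath-trivial a .step _ ()
  IsPath-trivial a .inj .0 .0 z≤n z≤n _ = refl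

  IsPath-take : ∀ {w k a b t} → t ≤ k → IsPath G w k a b → IsPath G w t a (w t)
  IsPath-take t≤k path .start = start path
  IsPath-take t≤k path .end   = refl
  IsPath-take t≤k path .step i i<t = step path i (<-≤-trans i<t t≤k)
  IsPath-take t≤k path .inj i j i≤t j≤t = inj path i j (≤-trans i≤t t≤k) (≤-trans j≤t t≤k)

  IsPath-drop : ∀ {w k a b t} → t ≤ k → IsPath G w k a b →
                IsPath G (λ i → w (t + i)) (k ∸ t) (w t) b
  IsPath-drop {w} {t = t} t≤k path =
    shift (subst (λ k → IsPath G w k _ _) (sym (m+[n∸m]≡n t≤k)) path)
    where
    shift : ∀ {l a b} → IsPath G w (t + l) a b → IsPath G (λ i → w (t + i)) l (w t) b
    shift path .start = cong w (+-identityʳ t)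
    shift path .end   = end path
    shift path .step i i<l = subst (λ j → Adj G (w (t + i)) (w j)) (sym (+-suc t i))
      (step path (t + i) (+-monoʳ-< t i<l))
    shift path .inj i j i≤l j≤l eq =
      +-cancelˡ-≡ t i j (inj path (t + i) (t + j) (+-monoʳ-≤ t i≤l) (+-monoʳ-≤ t j≤l) eq)

  IsPath-cons : ∀ {p k a b c} → Adj G a b → IsPath G p k b c → (∀ t → t ≤ k → p t ≢ a) →
                IsPath G (cons a p) (suc k) a c
  IsPath-cons a~b path fresh .start = refl
  IsPath-cons a~b path fresh .end   = end path
  IsPath-cons a~b path fresh .step zero    _         = subst (Adj G _) (sym (start path)) a~b
  IsPath-cons a~b path fresh .step (suc i) (s≤s i<k) = step path i i<k
  IsPath-cons a~b path fresh .inj zero    zero    _         _         _   = refl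
  IsPath-cons a~b path fresh .inj zero    (suc j) _         (s≤s j≤k) eq  = contradiction (sym eq) (fresh j j≤k)
  IsPath-cons a~b path fresh .inj (suc i) zero    (s≤s i≤k) _         eq  = contradiction eq (fresh i i≤k)
  IsPath-cons a~b path fresh .inj (suc i) (suc j) (s≤s i≤k) (s≤s j≤k) eq  =
    cong suc (inj path i j i≤k j≤k eq)

  -- If a already lies on the path, the path is restarted there instead of extended by a.
  Walk⇒IsPath : ∀ {a b l} → Walk G a b l → ∃₂ λ p l′ → l′ ≤ l × IsPath G p l′ a b
  Walk⇒IsPath {a} []  = (λ _ → a) , 0 , z≤n , IsPath-trivial a
  Walk⇒IsPath {a} {l = suc l} (a~b ∷ walk) with Walk⇒IsPath walk
  ... | p , l′ , l′≤l , path with anyUpTo? (λ t → p t ≟ a) (suc l′)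
  ...   | yes (t , s≤s t≤l′ , pt≡a) =
    (λ i → p (t + i)) , l′ ∸ t , ≤-trans (m∸n≤m l′ t) (m≤n⇒m≤1+n l′≤l) ,
    subst (λ s → IsPath G _ _ s _) pt≡a (IsPath-drop t≤l′ path)
  ...   | no absent =
    cons a p , suc l′ , s≤s l′≤l ,
    IsPath-cons a~b path (λ t t≤l′ pt≡a → absent (t , s≤s t≤l′ , pt≡a))

module _ {n : ℕ} {G : Graph n} {dist : Fin n → Fin n → Maybe ℕ} (isDist : IsDistFun G dist) where

  dist-path : ∀ {a b d} → dist a b ≡ just d → ∃ λ w → IsPath G w d a b
  dist-path {a} {b} eq with dist a b | isDist a b | eq
  ... | just _ | shortest , _ | refl = shortest

  dist-≤-walk : ∀ {a b l} → Walk G a b l → ∃ λ d → dist a b ≡ just d × d ≤ l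
  dist-≤-walk {a} {b} walk with Walk⇒IsPath walk | dist a b | isDist a b
  ... | p , l′ , l′≤l , path | just d  | _ , minimal = d , refl , ≤-trans (minimal p l′ path) l′≤l
  ... | p , l′ , _    , path | nothing | unreachable = contradiction path (unreachable p l′)

⊖-cancelʳ : ∀ c {a b} → a ⊖ c ≡ b ⊖ c → a ≡ b
⊖-cancelʳ c {a} {b} eq = ℤ.+-injective (∙-cancelʳ (ℤ.- ℤ.+ c) (ℤ.+ a) (ℤ.+ b)
  (trans (ℤ.m-n≡m⊖n a c) (trans eq (sym (ℤ.m-n≡m⊖n b c)))))

a-[1+c]≡b-c⇒a≡1+b : ∀ {a b : Maybe ℕ} c → a -∞ just (suc c) ≡ b -∞ just c → a ≡ 1 +∞ b
a-[1+c]≡b-c⇒a≡1+b {just a}  {just b}  c eq =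
  cong just (⊖-cancelʳ (suc c) (trans (just-injective eq) (sym (ℤ.[1+m]⊖[1+n]≡m⊖n b c))))
a-[1+c]≡b-c⇒a≡1+b {nothing} {nothing} c eq = refl

+∞-identityˡ : ∀ d → 0 +∞ d ≡ d
+∞-identityˡ = map-id

+∞-assoc : ∀ a b d → a +∞ (b +∞ d) ≡ (a + b) +∞ d
+∞-assoc a b d = trans (sym (map-∘ d)) (map-cong (λ e → sym (+-assoc a b e)) d)

module _ {n : ℕ} {G : Graph n} {dist : Fin n → Fin n → Maybe ℕ} (isDist : IsDistFun G dist)
         {R : Fin n → Set} {v₀ : Fin n} {P : ℕ → Fin n} {m : ℕ} {x : Fin n}
         (shortestToR : IsShortestPathToSet G dist R v₀ P m x) where

  private
    P-path : IsPath G P m v₀ x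
    P-path = proj₁ shortestToR

    x∈R : R x
    x∈R = proj₁ (proj₂ shortestToR)

    P-shortest : ∀ y → R y → ∀ k → dist v₀ y ≡ just k → m ≤ k
    P-shortest = proj₂ (proj₂ shortestToR)

  dist-to-end : ∀ {k} → k ≤ m → dist (P k) (P m) ≡ just (m ∸ k)
  dist-to-end {k} k≤m rewrite end P-path
    with d , dist≡d , d≤m∸k ← dist-≤-walk isDist (IsPath⇒Walk (IsPath-drop k≤m P-path)) =
    trans dist≡d (cong just (≤-antisym d≤m∸k (m≤n+o⇒m∸n≤o m k m≤k+d)))
    where
    m≤k+d : m ≤ k + d
    m≤k+d with Q , Q-path ← dist-path isDist dist≡d
          with e , dist≡e , e≤k+d ← dist-≤-walk isDist
                 (IsPath⇒Walk (IsPath-take k≤m P-path) ++ IsPath⇒Walk Q-path) =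
      ≤-trans (P-shortest x x∈R e dist≡e) e≤k+d

  dist-step : ∀ {k} → k < m → ¬ Milestone dist R P m k →
              ∀ y → R y → dist (P k) y ≡ 1 +∞ dist (P (suc k)) y
  dist-step {k} k<m notMilestone y y∈R = a-[1+c]≡b-c⇒a≡1+b (m ∸ suc k) (begin
    dist (P k) y -∞ just (suc (m ∸ suc k))      ≡⟨ cong (dist (P k) y -∞_) (sym toEnd) ⟩
    prof dist (P m) (P k) y                     ≡⟨ sameProfile ⟩
    prof dist (P m) (P (suc k)) y               ≡⟨ cong (dist (P (suc k)) y -∞_) (dist-to-end k<m) ⟩
    dist (P (suc k)) y -∞ just (m ∸ suc k)      ∎)
    where
    toEnd : dist (P k) (P m) ≡ just (suc (m ∸ suc k))
    toEnd = trans (dist-to-end (<⇒≤ k<m)) (cong just (+-∸-assoc 1 k<m))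

    sameProfile : prof dist (P m) (P k) y ≡ prof dist (P m) (P (suc k)) y
    sameProfile = decidable-stable (≡-dec ℤ._≟_ _ _)
      (λ differ → notMilestone (inj₂ (k<m , λ same → differ (same y y∈R))))

  dist-across-neutral : ∀ d {i} → i + d ≤ m → (∀ k → i ≤ k → k < i + d → ¬ Milestone dist R P m k) →
                        ∀ y → R y → dist (P i) y ≡ d +∞ dist (P (i + d)) y
  dist-across-neutral zero {i} _ _ y _ = begin
    dist (P i) y               ≡⟨ cong (λ k → dist (P k) y) (sym (+-identityʳ i)) ⟩
    dist (P (i + 0)) y         ≡⟨ sym (+∞-identityˡ _) ⟩
    0 +∞ dist (P (i + 0)) y    ∎
  dist-across-neutral (suc d) {i} i+1+d≤m neutral y y∈R = begin
    dist (P i) y                          ≡⟨ dist-step (<-≤-trans i<i+1+d i+1+d≤m) (neutral i ≤-refl i<i+1+d) y y∈R ⟩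
    1 +∞ dist (P (suc i)) y               ≡⟨ cong (1 +∞_) rest ⟩
    1 +∞ (d +∞ dist (P (suc i + d)) y)    ≡⟨ +∞-assoc 1 d (dist (P (suc i + d)) y) ⟩
    suc d +∞ dist (P (suc i + d)) y       ≡⟨ cong (λ k → suc d +∞ dist (P k) y) (sym (+-suc i d)) ⟩
    suc d +∞ dist (P (i + suc d)) y       ∎
    where
    i<i+1+d : i < i + suc d
    i<i+1+d = m<m+n i (s≤s z≤n)
    rest : dist (P (suc i)) y ≡ d +∞ dist (P (suc i + d)) y
    rest = dist-across-neutral d (subst (_≤ m) (+-suc i d) i+1+d≤m)
      (λ k i<k k<i+d → neutral k (<⇒≤ i<k) (subst (k <_) (sym (+-suc i d)) k<i+d)) y y∈R

lemma3p1 : {n : ℕ} (G : Graph n) (dist : Fin n → Fin n → Maybe ℕ) →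
    IsDistFun G dist →
    (R : Fin n → Set) (v₀ : Fin n) (P : ℕ → Fin n) (m : ℕ) (x : Fin n) →
    IsShortestPathToSet G dist R v₀ P m x →
    ∀ (j : ℕ) → j ≤ m → Milestone dist R P m j →
    ∀ (i : ℕ) → InNeutralPrefix dist R P m j i →
    ∀ (y : Fin n) → R y →
    dist (P i) y ≡ (j ∸ i) +∞ dist (P j) y
lemma3p1 G dist isDist R v₀ P m x shortestToR j j≤m _ i (i≤j , neutral) y y∈R
  with j ∸ i | m+[n∸m]≡n i≤j
... | d | refl = dist-across-neutral isDist shortestToR d j≤m neutral y y∈R
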